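{- Let $k\ge1$, $m\ge0$, $q\ge1$ be integers and for $(t,\eta)\in\mathbb{P}\times\mathbb{P}$ let $$f(t,\eta)=f_{m,k}(t,\eta)=\sum_{\deg Y\le k-1}\sum_{\deg Z\le m}E(tYZ)\sum_{\deg U\le 0}E(\eta YU).$$ Then $f(t,\eta)=2^{k+m+2-r(D^{[1;1+m]\times k}(t,\eta))}$ and $$\int_{\mathbb{P}}\int_{\mathbb{P}}f^q(t,\eta)\,dt\,d\eta=2^{q(k+m+2)-2k-m}\sum_{i=0}^{\min(k,2+m)}\Gamma_i^{[1;1+m]\times k}2^{ -iq}.$$
   Context: $\mathbb{K}=\mathbb{F}_2((T^{ -1}))$; $\mathbb{P}=\{\sum_{i\ge1}\alpha_iT^{ -i}\}$ is the unit interval with Haar measure of total mass $1$. $E(t)=(-1)^{\alpha_1}$, $\alpha_1$ the coefficient of $T^{ -1}$. Sums are over polynomials in $\mathbb{F}_2[T]$ with the given degree bounds (zero polynomial included). For $t=\sum\alpha_iT^{ -i}$, $\eta=\sum\beta_iT^{ -i}$, $D^{[1;1+m]\times k}(t,\eta)$ is the $(2+m)\times k$ matrix over $\mathbb{F}_2$ whose first $1+m$ rows are the persymmetric matrix $(\alpha_{i+j-1})_{1\le i\le 1+m,1\le j\le k}$ and whose last row is $(\beta_1,\dots,\beta_k)$; $r$ is rank over $\mathbb{F}_2$. $\Gamma_i^{[1;1+m]\times k}$ is the number of $(2+m)\times k$ matrices over $\mathbb{F}_2$ whose top $(1+m)\times k$ block is persymmetric and whose last row is arbitrary, having rank $i$.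 -}

module Defs where

open import Data.Bool using (Bool; true; false; _xor_; _∧_; if_then_else_)
open import Data.Nat as ℕ using (ℕ; zero; suc; _⊔_; _≡ᵇ_)
open import Data.Integer as ℤ using (ℤ; +_; -[1+_])
open import Data.Rational as ℚ using (ℚ; ½)
open import Data.List using (List; []; _∷_; map; concatMap; length; foldr; upTo; zipWith)

anyᵇ : {A : Set} → (A → Bool) → List A → Bool
anyᵇ p []       = false
anyᵇ p (x ∷ xs) = if p x then true else anyᵇ p xs

allᵇ : {A : Set} → (A → Bool) → List A → Bool
allᵇ p []       = true
allᵇ p (x ∷ xs) = if p x then allᵇ p xs else false

sumℕ : List ℕ → ℕ
sumℕ = foldr ℕ._+_ 0

-- F₂ and polynomials in F₂[T]
-- A polynomial is its coefficient list (a₀ ∷ a₁ ∷ …), index = degree.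

Poly : Set
Poly = List Bool

addP : Poly → Poly → Poly
addP []      q       = q
addP p       []      = p
addP (a ∷ p) (b ∷ q) = (a xor b) ∷ addP p q

scaleP : Bool → Poly → Poly
scaleP b p = map (b ∧_) p

mulP : Poly → Poly → Poly
mulP []      q = []
mulP (a ∷ p) q = addP (scaleP a q) (false ∷ mulP p q)

-- all coefficient lists of length n, i.e. all polynomials of degree ≤ n-1
-- (zero polynomial included); also all vectors of F₂ⁿ
vecs : ℕ → List (List Bool)
vecs zero    = [] ∷ []
vecs (suc n) = concatMap (λ v → (false ∷ v) ∷ (true ∷ v) ∷ []) (vecs n)

polysDegLe : ℕ → List Poly
polysDegLe d = vecs (suc d)

-- The unit interval ℙ of K = F₂((T⁻¹)):
-- t = Σ_{i≥1} αᵢ T⁻ⁱ is represented by  t : ℕ → Bool,  t i = α_{i+1}.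

ℙ : Set
ℙ = ℕ → Bool

shift : ℙ → ℙ
shift t i = t (suc i)

coeffT⁻¹ : ℙ → Poly → Bool
coeffT⁻¹ t []      = false
coeffT⁻¹ t (a ∷ p) = (a ∧ t 0) xor coeffT⁻¹ (shift t) p

-- E(t·P) = (-1)^{α₁(t·P)}   (the T⁻¹ coefficient does not see the
-- polynomial part of t·P, so E(tP) only depends on it)
E : ℙ → Poly → ℤ
E t P = if coeffT⁻¹ t P then ℤ.-[1+ 0 ] else ℤ.+ 1

sumℤ : List ℤ → ℤ
sumℤ = foldr ℤ._+_ (ℤ.+ 0)

sumℚ : List ℚ → ℚ
sumℚ = foldr ℚ._+_ ℚ.0ℚ

f : (m k : ℕ) → ℙ → ℙ → ℤ
f m k t η =
  sumℤ (map (λ Y →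
    sumℤ (map (λ Z → E t (mulP Y Z)) (polysDegLe m))
    ℤ.* sumℤ (map (λ U → E η (mulP Y U)) (polysDegLe 0)))
  (vecs k))

Row : Set
Row = List Bool

nonzero : Row → Bool
nonzero = anyᵇ (λ b → b)

linComb : List Bool → List Row → Row
linComb c vs = foldr addP [] (zipWith scaleP c vs)

independent : List Row → Bool
independent vs =
  allᵇ (λ c → if nonzero c then nonzero (linComb c vs) else true)
      (vecs (length vs))

sublists : {A : Set} → List A → List (List A)
sublists []       = [] ∷ []
sublists (x ∷ xs) = concatMap (λ s → s ∷ (x ∷ s) ∷ []) (sublists xs)

maxℕ : List ℕ → ℕ
maxℕ = foldr _⊔_ 0

rank : List Row → ℕ
rank M = maxℕ (map length (Data.List.filterᵇ independent (sublists M)))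
  where import Data.List

-- D^{[1;1+m]×k}(t,η): rows i = 0..m are (α_{i+j+1})_{j<k} (0-based i,j,
-- i.e. α_{i+j-1} in 1-based indexing), last row (β_{j+1})_{j<k}
D : (m k : ℕ) → ℙ → ℙ → List Row
D m k t η =
  map (λ i → map (λ j → t (i ℕ.+ j)) (upTo k)) (upTo (suc m))
  Data.List.++ (map η (upTo k) ∷ [])
  where import Data.List

-- Γ_i^{[1;1+m]×k}: number of (2+m)×k matrices over F₂ with persymmetric
-- top (1+m)×k block and arbitrary last row, of rank i.  Such a matrix is
-- determined by (α₁,…,α_{k+m}) and (β₁,…,β_k).

ext : List Bool → ℙ
ext []      i       = false
ext (b ∷ l) zero    = b
ext (b ∷ l) (suc i) = ext l i

count : {A : Set} → (A → Bool) → List A → ℕ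
count p []       = 0
count p (x ∷ xs) = if p x then suc (count p xs) else count p xs

Γ : (m k i : ℕ) → ℕ
Γ m k i =
  sumℕ (map (λ a → count (λ b → rank (D m k (ext a) (ext b)) ≡ᵇ i) (vecs k))
             (vecs (k ℕ.+ m)))
  where import Data.Nat

pow2ℕ : ℕ → ℚ
pow2ℕ zero    = ℚ.1ℚ
pow2ℕ (suc n) = (ℚ.1ℚ ℚ.+ ℚ.1ℚ) ℚ.* pow2ℕ n

halfPow : ℕ → ℚ
halfPow zero    = ℚ.1ℚ
halfPow (suc n) = ½ ℚ.* halfPow n

pow2 : ℤ → ℚ
pow2 (+ n)      = pow2ℕ n
pow2 -[1+ n ]   = halfPow (suc n)

-- Haar integral over ℙ × ℙ of a function depending only on the first N₁
-- coefficients of t and the first N₂ coefficients of η: the cylinder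
-- sets {α₁..α_{N₁} fixed} × {β₁..β_{N₂} fixed} each have measure
-- 2^{-(N₁+N₂)}, so the integral is this finite average.

integralℙ² : (N₁ N₂ : ℕ) → (ℙ → ℙ → ℚ) → ℚ
integralℙ² N₁ N₂ F =
  sumℚ (map (λ a → sumℚ (map (λ b → F (ext a) (ext b)) (vecs N₂))) (vecs N₁))
  ℚ.* halfPow (N₁ ℕ.+ N₂)

-- For fixed Y, E(tYZ) = (-1)^⟨w,Z⟩ where wᵢ is the coefficient of T⁻¹ in Tⁱ·t·Y, so the sum over
-- deg Z ≤ m is a character sum over F₂^{m+1}: it equals 2^{m+1} if w₀ = … = w_m = 0 and vanishes
-- otherwise.  Likewise the sum over deg U ≤ 0 detects the coefficient of T⁻¹ in η·Y.  These m + 2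
-- conditions say D·Y = 0, so f = 2^{m+2}·#ker D, and #ker D = 2^{k - r(D)}.  The kernel count
-- #ker M · 2^{r(M)} = 2^k is proved by double counting characters when the rows of M are independent,
-- and in general by passing to a greedy basis of the rows, which attains the maximum defining the rank.
-- Finally f depends only on α₁ … α_{k+m} and β₁ … β_k, so the Haar integral is a finite average, and
-- grouping its terms by the rank of D produces the numbers Γᵢ.

module Submission where

open import Defs
open import Data.Nat using (ℕ; suc; _+_; _*_; _∸_; _≤_; _⊓_; _^_)
open import Data.Integer as ℤ using (ℤ; +_)
open import Data.Rational as ℚ using (ℚ)
open import Data.List using (map; upTo)
open import Data.Product using (_×_)
open import Relation.Binary.PropositionalEquality using (_≡_)

open import Algebra.Bundles using (CommutativeSemigroup)
open import Algebra.Structures using (IsCommutativeRing)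
open import Data.Bool using (Bool; true; false; not; _∧_; _∨_; _xor_; if_then_else_; T?)
open import Data.Bool.Properties
  using (∧-comm; ∧-zeroʳ; xor-identityʳ; xor-∧-commutativeRing; not-injective; if-not; T-≡; T-not-≡; ⇔→≡)
open import Data.Empty using (⊥-elim)
open import Data.List using (List; []; _∷_; _++_; length; foldr; concatMap; applyUpTo; filterᵇ)
open import Data.List.Membership.Propositional using (_∈_)
open import Data.List.Membership.Propositional.Properties using (∈-filter⁺; ∈-filter⁻)
open import Data.List.Relation.Binary.Sublist.Propositional using (_⊆_; []; _∷_; _∷ʳ_)
open import Data.List.Relation.Binary.Sublist.Propositional.Properties using (All-resp-⊆)
open import Data.List.Relation.Unary.All as All using (All; []; _∷_)
open import Data.List.Relation.Unary.Any as Any using (here; there)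
open import Data.Maybe using (nothing)
open import Data.Nat using (zero; _<_; _≡ᵇ_; _≤?_; z≤n; s≤s)
open import Data.Product using (_,_; ∃; proj₁; proj₂)
open import Function using (_∘_; id; _⇔_; mk⇔; Equivalence)
open import Level using (0ℓ)
open import Relation.Binary.PropositionalEquality using (refl; sym; trans; cong; cong₂; subst; module ≡-Reasoning)
open import Relation.Nullary using (yes; no)
open import Tactic.RingSolver using (solve-∀)
open import Tactic.RingSolver.Core.AlmostCommutativeRing using (AlmostCommutativeRing; fromCommutativeRing)
import Data.Integer.Properties as ℤₚ
import Data.List.Properties as Listₚ
import Data.List.Relation.Binary.Sublist.Heterogeneous.Properties as Sublistₚ
import Data.List.Relation.Unary.All.Properties as Allₚ
import Data.List.Relation.Unary.Any.Properties as Anyₚ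
import Data.Nat.Coprimality as Coprime
import Data.Nat.Properties as ℕₚ
import Data.Nat.Tactic.RingSolver as ℕ-Solver
import Data.Rational.Properties as ℚₚ
import Function.Properties.Equivalence as ⇔

private variable
  B C : Set

allᵇ⇒All : ∀ (p : B → Bool) xs → allᵇ p xs ≡ true → All (λ x → p x ≡ true) xs
allᵇ⇒All p []       _  = []
allᵇ⇒All p (x ∷ xs) all≡ with p x in px≡
... | true = px≡ ∷ allᵇ⇒All p xs all≡

All⇒allᵇ : ∀ (p : B → Bool) xs → All (λ x → p x ≡ true) xs → allᵇ p xs ≡ true
All⇒allᵇ p []       []           = refl
All⇒allᵇ p (x ∷ xs) (px≡ ∷ all≡) rewrite px≡ = All⇒allᵇ p xs all≡

anyᵇ⇒∃ : ∀ (p : B → Bool) xs → anyᵇ p xs ≡ true → ∃ λ x → p x ≡ true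
anyᵇ⇒∃ p (x ∷ xs) any≡ with p x in px≡
... | true  = x , px≡
... | false = anyᵇ⇒∃ p xs any≡

anyᵇ≡false⇒All : ∀ (p : B → Bool) xs → anyᵇ p xs ≡ false → All (λ x → p x ≡ false) xs
anyᵇ≡false⇒All p []       _    = []
anyᵇ≡false⇒All p (x ∷ xs) any≡ with p x in px≡
... | false = px≡ ∷ anyᵇ≡false⇒All p xs any≡

count-mono : ∀ (p q : B → Bool) xs → (∀ x → p x ≡ true → q x ≡ true) → count p xs ≤ count q xs
count-mono p q []       _   = z≤n
count-mono p q (x ∷ xs) p⇒q with p x in px≡ | q x in qx≡
... | true  | true  = s≤s (count-mono p q xs p⇒q)
... | false | true  = ℕₚ.m≤n⇒m≤1+n (count-mono p q xs p⇒q)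
... | false | false = count-mono p q xs p⇒q
... | true  | false with () ← trans (sym (p⇒q x px≡)) qx≡

count-cong : ∀ {p q : B → Bool} xs → (∀ x → p x ≡ q x) → count p xs ≡ count q xs
count-cong          []       _   = refl
count-cong {q = q} (x ∷ xs) p≗q rewrite p≗q x = cong (λ n → if q x then suc n else n) (count-cong xs p≗q)

All-vecs-suc : ∀ {P : List Bool → Set} n →
  All (λ v → P (false ∷ v)) (vecs n) → All (λ v → P (true ∷ v)) (vecs n) → All P (vecs (suc n))
All-vecs-suc n Pf Pt = Allₚ.concat⁺ (Allₚ.map⁺ (All.zipWith (λ (p , q) → p ∷ q ∷ []) (Pf , Pt)))

vecs-length : ∀ n → All (λ v → length v ≡ n) (vecs n)
vecs-length zero    = refl ∷ []
vecs-length (suc n) = All-vecs-suc n (All.map (cong suc) (vecs-length n)) (All.map (cong suc) (vecs-length n))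

module FiniteSums {A : Set} {_⊕_ _⊗_ : A → A → A} {⊖_ : A → A} {0# 1# : A}
                  (isCommutativeRing : IsCommutativeRing _≡_ _⊕_ _⊗_ ⊖_ 0# 1#) where

  open IsCommutativeRing isCommutativeRing
    using (+-assoc; +-identityˡ; +-identityʳ; +-isCommutativeSemigroup; *-comm; distribˡ; zeroʳ)
  open ≡-Reasoning

  +-commutativeSemigroup : CommutativeSemigroup 0ℓ 0ℓ
  +-commutativeSemigroup = record { isCommutativeSemigroup = +-isCommutativeSemigroup }

  open import Algebra.Properties.CommutativeSemigroup +-commutativeSemigroup using (interchange)

  ∑ : List B → (B → A) → A
  ∑ xs g = foldr _⊕_ 0# (map g xs)

  syntax ∑ xs (λ x → e) = ∑[ x ∈ xs ] e

  ∑-cong : ∀ {g h : B → A} xs → (∀ x → g x ≡ h x) → ∑ xs g ≡ ∑ xs h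
  ∑-cong []       g≗h = refl
  ∑-cong (x ∷ xs) g≗h = cong₂ _⊕_ (g≗h x) (∑-cong xs g≗h)

  ∑-cong-All : ∀ {g h : B → A} {xs} → All (λ x → g x ≡ h x) xs → ∑ xs g ≡ ∑ xs h
  ∑-cong-All []             = refl
  ∑-cong-All (gx≡hx ∷ g≗h) = cong₂ _⊕_ gx≡hx (∑-cong-All g≗h)

  ∑-cong-vecs : ∀ {g h : List Bool → A} n → (∀ v → length v ≡ n → g v ≡ h v) → ∑ (vecs n) g ≡ ∑ (vecs n) h
  ∑-cong-vecs n g≗h = ∑-cong-All (All.map (g≗h _) (vecs-length n))

  ∑-0# : (xs : List B) → ∑[ _ ∈ xs ] 0# ≡ 0#
  ∑-0# []       = refl
  ∑-0# (_ ∷ xs) = trans (+-identityˡ _) (∑-0# xs)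

  ∑-⊕ : ∀ (g h : B → A) xs → ∑[ x ∈ xs ] (g x ⊕ h x) ≡ ∑ xs g ⊕ ∑ xs h
  ∑-⊕ g h []       = sym (+-identityʳ 0#)
  ∑-⊕ g h (x ∷ xs) = trans (cong ((g x ⊕ h x) ⊕_) (∑-⊕ g h xs)) (interchange (g x) (h x) (∑ xs g) (∑ xs h))

  ∑-⊗ˡ : ∀ c (g : B → A) xs → ∑[ x ∈ xs ] (c ⊗ g x) ≡ c ⊗ ∑ xs g
  ∑-⊗ˡ c g []       = sym (zeroʳ c)
  ∑-⊗ˡ c g (x ∷ xs) = trans (cong ((c ⊗ g x) ⊕_) (∑-⊗ˡ c g xs)) (sym (distribˡ c (g x) (∑ xs g)))

  ∑-⊗ʳ : ∀ c (g : B → A) xs → ∑[ x ∈ xs ] (g x ⊗ c) ≡ ∑ xs g ⊗ c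
  ∑-⊗ʳ c g xs = trans (∑-cong xs (λ x → *-comm (g x) c)) (trans (∑-⊗ˡ c g xs) (*-comm c (∑ xs g)))

  ∑-comm : ∀ (F : B → C → A) xs ys → ∑[ x ∈ xs ] ∑[ y ∈ ys ] F x y ≡ ∑[ y ∈ ys ] ∑[ x ∈ xs ] F x y
  ∑-comm F []       ys = sym (∑-0# ys)
  ∑-comm F (x ∷ xs) ys =
    trans (cong (∑ ys (F x) ⊕_) (∑-comm F xs ys)) (sym (∑-⊕ (F x) (λ y → ∑[ x ∈ xs ] F x y) ys))

  ∑-vecs-suc : ∀ n (g : List Bool → A) → ∑ (vecs (suc n)) g ≡ ∑[ v ∈ vecs n ] (g (false ∷ v) ⊕ g (true ∷ v))
  ∑-vecs-suc n g = go (vecs n)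
    where
    go : ∀ vs → ∑ (concatMap (λ v → (false ∷ v) ∷ (true ∷ v) ∷ []) vs) g ≡ ∑[ v ∈ vs ] (g (false ∷ v) ⊕ g (true ∷ v))
    go []       = refl
    go (v ∷ vs) = trans (cong (λ s → g (false ∷ v) ⊕ (g (true ∷ v) ⊕ s)) (go vs)) (sym (+-assoc _ _ _))

  ∑-vecs-+ : ∀ n d (g : List Bool → A) → ∑ (vecs (n + d)) g ≡ ∑[ u ∈ vecs n ] ∑[ v ∈ vecs d ] g (u ++ v)
  ∑-vecs-+ zero    d g = sym (+-identityʳ _)
  ∑-vecs-+ (suc n) d g = begin
    ∑ (vecs (suc n + d)) g
      ≡⟨ ∑-vecs-suc (n + d) g ⟩
    ∑[ w ∈ vecs (n + d) ] (g (false ∷ w) ⊕ g (true ∷ w))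
      ≡⟨ ∑-⊕ _ _ (vecs (n + d)) ⟩
    (∑[ w ∈ vecs (n + d) ] g (false ∷ w)) ⊕ (∑[ w ∈ vecs (n + d) ] g (true ∷ w))
      ≡⟨ cong₂ _⊕_ (∑-vecs-+ n d _) (∑-vecs-+ n d _) ⟩
    (∑[ u ∈ vecs n ] G (false ∷ u)) ⊕ (∑[ u ∈ vecs n ] G (true ∷ u))
      ≡⟨ sym (∑-⊕ _ _ (vecs n)) ⟩
    ∑[ u ∈ vecs n ] (G (false ∷ u) ⊕ G (true ∷ u))
      ≡⟨ sym (∑-vecs-suc n G) ⟩
    ∑ (vecs (suc n)) G ∎
    where
    G : List Bool → A
    G u = ∑[ v ∈ vecs d ] g (u ++ v)

  ∑-vecs-δ : ∀ n K → ∑[ c ∈ vecs n ] (if nonzero c then 0# else K) ≡ K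
  ∑-vecs-δ zero    K = +-identityʳ K
  ∑-vecs-δ (suc n) K =
    trans (∑-vecs-suc n _) (trans (∑-cong (vecs n) (λ _ → +-identityʳ _)) (∑-vecs-δ n K))

  ∑-upTo-suc : ∀ n (g : ℕ → A) → ∑ (upTo (suc n)) g ≡ g 0 ⊕ (∑[ i ∈ upTo n ] g (suc i))
  ∑-upTo-suc n g =
    cong (λ xs → g 0 ⊕ foldr _⊕_ 0# xs) (trans (Listₚ.map-applyUpTo suc g n) (sym (Listₚ.map-upTo (g ∘ suc) n)))

module Σℤ = FiniteSums ℤₚ.+-*-isCommutativeRing

𝔽₂ : AlmostCommutativeRing 0ℓ 0ℓ
𝔽₂ = fromCommutativeRing xor-∧-commutativeRing (λ _ → nothing)

-- Tⁱ·t with its polynomial part dropped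
shiftBy : ℕ → ℙ → ℙ
shiftBy i t x = t (i + x)

coeffT⁻¹-cong : ∀ {t t′} p → (∀ i → i < length p → t i ≡ t′ i) → coeffT⁻¹ t p ≡ coeffT⁻¹ t′ p
coeffT⁻¹-cong []      t≗t′ = refl
coeffT⁻¹-cong (a ∷ p) t≗t′ =
  cong₂ (λ x y → (a ∧ x) xor y) (t≗t′ 0 (s≤s z≤n)) (coeffT⁻¹-cong p (λ i i<|p| → t≗t′ (suc i) (s≤s i<|p|)))

coeffT⁻¹-0 : ∀ p → coeffT⁻¹ (λ _ → false) p ≡ false
coeffT⁻¹-0 []      = refl
coeffT⁻¹-0 (a ∷ p) = trans (cong (_xor coeffT⁻¹ (λ _ → false) p) (∧-zeroʳ a)) (coeffT⁻¹-0 p)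

coeffT⁻¹-zeroᵖ : ∀ t p → nonzero p ≡ false → coeffT⁻¹ t p ≡ false
coeffT⁻¹-zeroᵖ t []          _   = refl
coeffT⁻¹-zeroᵖ t (false ∷ p) p≡0 = coeffT⁻¹-zeroᵖ (shift t) p p≡0
coeffT⁻¹-zeroᵖ t (true ∷ p)  ()

coeffT⁻¹-addP : ∀ t p q → coeffT⁻¹ t (addP p q) ≡ coeffT⁻¹ t p xor coeffT⁻¹ t q
coeffT⁻¹-addP t []      q       = refl
coeffT⁻¹-addP t (a ∷ p) []      = sym (xor-identityʳ _)
coeffT⁻¹-addP t (a ∷ p) (b ∷ q) =
  trans (cong ((a xor b) ∧ t 0 xor_) (coeffT⁻¹-addP (shift t) p q)) (interchange a b (t 0) _ _)
  where
  interchange : ∀ a b x u v → ((a xor b) ∧ x) xor (u xor v) ≡ ((a ∧ x) xor u) xor ((b ∧ x) xor v)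
  interchange = solve-∀ 𝔽₂

coeffT⁻¹-scaleP : ∀ t a p → coeffT⁻¹ t (scaleP a p) ≡ a ∧ coeffT⁻¹ t p
coeffT⁻¹-scaleP t a []      = sym (∧-zeroʳ a)
coeffT⁻¹-scaleP t a (b ∷ p) =
  trans (cong ((a ∧ b) ∧ t 0 xor_) (coeffT⁻¹-scaleP (shift t) a p)) (factor a b (t 0) _)
  where
  factor : ∀ a b x u → ((a ∧ b) ∧ x) xor (a ∧ u) ≡ a ∧ ((b ∧ x) xor u)
  factor = solve-∀ 𝔽₂

coeffT⁻¹-linear : ∀ a t s p → coeffT⁻¹ (λ i → (a ∧ t i) xor s i) p ≡ (a ∧ coeffT⁻¹ t p) xor coeffT⁻¹ s p
coeffT⁻¹-linear a t s []      = sym (trans (xor-identityʳ _) (∧-zeroʳ a))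
coeffT⁻¹-linear a t s (c ∷ p) =
  trans (cong (c ∧ ((a ∧ t 0) xor s 0) xor_) (coeffT⁻¹-linear a (shift t) (shift s) p))
        (rearrange a c (t 0) (s 0) _ _)
  where
  rearrange : ∀ a c x y u v → (c ∧ ((a ∧ x) xor y)) xor ((a ∧ u) xor v) ≡ (a ∧ ((c ∧ x) xor u)) xor ((c ∧ y) xor v)
  rearrange = solve-∀ 𝔽₂

coeffT⁻¹-mulP : ∀ t Y Z → coeffT⁻¹ t (mulP Y Z) ≡ coeffT⁻¹ (λ i → coeffT⁻¹ (shiftBy i t) Y) Z
coeffT⁻¹-mulP t []      Z = sym (coeffT⁻¹-0 Z)
coeffT⁻¹-mulP t (a ∷ Y) Z = begin
  coeffT⁻¹ t (addP (scaleP a Z) (false ∷ mulP Y Z))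
    ≡⟨ coeffT⁻¹-addP t (scaleP a Z) (false ∷ mulP Y Z) ⟩
  coeffT⁻¹ t (scaleP a Z) xor coeffT⁻¹ (shift t) (mulP Y Z)
    ≡⟨ cong₂ _xor_ (coeffT⁻¹-scaleP t a Z) (coeffT⁻¹-mulP (shift t) Y Z) ⟩
  (a ∧ coeffT⁻¹ t Z) xor coeffT⁻¹ (λ i → coeffT⁻¹ (shiftBy i (shift t)) Y) Z
    ≡⟨ sym (coeffT⁻¹-linear a t _ Z) ⟩
  coeffT⁻¹ (λ i → (a ∧ t i) xor coeffT⁻¹ (shiftBy i (shift t)) Y) Z
    ≡⟨ coeffT⁻¹-cong Z (λ i _ → cong₂ (λ x y → (a ∧ x) xor y) (cong t (sym (ℕₚ.+-identityʳ i)))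
                                       (coeffT⁻¹-cong Y (λ j _ → cong t (sym (ℕₚ.+-suc i j))))) ⟩
  coeffT⁻¹ (λ i → coeffT⁻¹ (shiftBy i t) (a ∷ Y)) Z ∎
  where open ≡-Reasoning

-- The dot product on F₂-vectors, the shorter one padded with zeros
infix 7 _·_
_·_ : List Bool → List Bool → Bool
p · q = coeffT⁻¹ (ext q) p

·-comm : ∀ p q → p · q ≡ q · p
·-comm []      q       = sym (coeffT⁻¹-0 q)
·-comm (a ∷ p) []      = coeffT⁻¹-0 (a ∷ p)
·-comm (a ∷ p) (b ∷ q) = cong₂ _xor_ (∧-comm a b) (·-comm p q)

ext-map-applyUpTo : ∀ (s : ℙ) f {n i} → i < n → ext (map s (applyUpTo f n)) i ≡ s (f i)
ext-map-applyUpTo s f {suc n} {zero}  _         = refl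
ext-map-applyUpTo s f {suc n} {suc i} (s≤s i<n) = ext-map-applyUpTo s (f ∘ suc) i<n

·-prefix : ∀ s {n} p → length p ≤ n → p · map s (upTo n) ≡ coeffT⁻¹ s p
·-prefix s p |p|≤n = coeffT⁻¹-cong p (λ i i<|p| → ext-map-applyUpTo s id (ℕₚ.<-≤-trans i<|p| |p|≤n))

sign : Bool → ℤ
sign b = if b then ℤ.-[1+ 0 ] else + 1

sign-cancel : ∀ b → sign b ℤ.+ sign (not b) ≡ + 0
sign-cancel false = refl
sign-cancel true  = refl

sign-twice : ∀ b → sign b ℤ.+ sign b ≡ + 2 ℤ.* sign b
sign-twice false = refl
sign-twice true  = refl

character-sum-twice : ∀ n w → Σℤ.∑[ c ∈ vecs n ] sign (c · w) ≡ (if nonzero w then + 0 else + (2 ^ n)) →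
  Σℤ.∑[ c ∈ vecs n ] (sign (c · w) ℤ.+ sign (c · w)) ≡ (if nonzero w then + 0 else + (2 ^ suc n))
character-sum-twice n w ∑≡ = begin
  Σℤ.∑[ c ∈ vecs n ] (sign (c · w) ℤ.+ sign (c · w))  ≡⟨ Σℤ.∑-cong (vecs n) (λ c → sign-twice (c · w)) ⟩
  Σℤ.∑[ c ∈ vecs n ] (+ 2 ℤ.* sign (c · w))           ≡⟨ Σℤ.∑-⊗ˡ (+ 2) _ (vecs n) ⟩
  + 2 ℤ.* Σℤ.∑[ c ∈ vecs n ] sign (c · w)             ≡⟨ cong (+ 2 ℤ.*_) ∑≡ ⟩
  + 2 ℤ.* (if nonzero w then + 0 else + (2 ^ n))      ≡⟨ double (nonzero w) ⟩
  (if nonzero w then + 0 else + (2 ^ suc n))          ∎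
  where
  open ≡-Reasoning
  double : ∀ b → + 2 ℤ.* (if b then + 0 else + (2 ^ n)) ≡ (if b then + 0 else + (2 ^ suc n))
  double false = sym (ℤₚ.pos-* 2 (2 ^ n))
  double true  = refl

-- When w is [] or false ∷ w′, the two halves c ↦ (false ∷ c) · w and c ↦ (true ∷ c) · w of the sum coincide.
character-sum : ∀ n w → length w ≤ n → Σℤ.∑[ c ∈ vecs n ] sign (c · w) ≡ (if nonzero w then + 0 else + (2 ^ n))
character-sum zero    []          _           = refl
character-sum (suc n) []          _           =
  trans (Σℤ.∑-vecs-suc n _) (character-sum-twice n [] (character-sum n [] z≤n))
character-sum (suc n) (false ∷ w) (s≤s |w|≤n) =
  trans (Σℤ.∑-vecs-suc n _) (character-sum-twice n w (character-sum n w |w|≤n))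
character-sum (suc n) (true ∷ w)  _           =
  trans (Σℤ.∑-vecs-suc n _) (trans (Σℤ.∑-cong (vecs n) (λ c → sign-cancel (c · w))) (Σℤ.∑-0# (vecs n)))

∑-if : ∀ (p : B → Bool) a xs → Σℤ.∑[ x ∈ xs ] (if p x then a else + 0) ≡ a ℤ.* + count p xs
∑-if p a []       = sym (ℤₚ.*-zeroʳ a)
∑-if p a (x ∷ xs) with p x
... | true  = trans (cong (ℤ._+_ a) (∑-if p a xs)) (sym (ℤₚ.*-suc a (+ count p xs)))
... | false = trans (ℤₚ.+-identityˡ _) (∑-if p a xs)

_⊛_ : List Row → List Bool → List Bool
M ⊛ Y = map (_· Y) M

_∈Ker_ : List Bool → List Row → Set
Y ∈Ker M = All (λ r → r · Y ≡ false) M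

inKernel : List Row → List Bool → Bool
inKernel M Y = not (nonzero (M ⊛ Y))

nonzero≡false⇔ : ∀ w → nonzero w ≡ false ⇔ All (_≡ false) w
nonzero≡false⇔ []          = mk⇔ (λ _ → []) (λ _ → refl)
nonzero≡false⇔ (false ∷ w) = mk⇔ (λ w≡0 → refl ∷ Equivalence.to (nonzero≡false⇔ w) w≡0)
                                 (λ { (_ ∷ w≡0) → Equivalence.from (nonzero≡false⇔ w) w≡0 })
nonzero≡false⇔ (true ∷ w)  = mk⇔ (λ ()) (λ { (() ∷ _) })

inKernel⇔∈Ker : ∀ M Y → inKernel M Y ≡ true ⇔ Y ∈Ker M
inKernel⇔∈Ker M Y =
  ⇔.trans (⇔.trans (⇔.sym T-≡) T-not-≡) (⇔.trans (nonzero≡false⇔ (M ⊛ Y)) (mk⇔ Allₚ.map⁻ Allₚ.map⁺))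

·-zeroʳ : ∀ c w → nonzero w ≡ false → c · w ≡ false
·-zeroʳ c w w≡0 = trans (·-comm c w) (coeffT⁻¹-zeroᵖ (ext c) w w≡0)

·-linComb : ∀ c B Y → c · (B ⊛ Y) ≡ linComb c B · Y
·-linComb []      B       Y = refl
·-linComb (a ∷ c) []      Y = coeffT⁻¹-0 (a ∷ c)
·-linComb (a ∷ c) (b ∷ B) Y = sym (begin
  addP (scaleP a b) (linComb c B) · Y      ≡⟨ coeffT⁻¹-addP (ext Y) (scaleP a b) (linComb c B) ⟩
  scaleP a b · Y xor linComb c B · Y       ≡⟨ cong₂ _xor_ (coeffT⁻¹-scaleP (ext Y) a b) (sym (·-linComb c B Y)) ⟩
  (a ∧ b · Y) xor c · (B ⊛ Y)              ∎)
  where open ≡-Reasoning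

RowsOfWidth≤ : ℕ → List Row → Set
RowsOfWidth≤ k M = All (λ r → length r ≤ k) M

length-addP : ∀ {k} p q → length p ≤ k → length q ≤ k → length (addP p q) ≤ k
length-addP []      q       _           |q|≤k       = |q|≤k
length-addP (a ∷ p) []      |p|≤k       _           = |p|≤k
length-addP (a ∷ p) (b ∷ q) (s≤s |p|≤k) (s≤s |q|≤k) = s≤s (length-addP p q |p|≤k |q|≤k)

length-linComb : ∀ {k} c B → RowsOfWidth≤ k B → length (linComb c B) ≤ k
length-linComb []      B       _               = z≤n
length-linComb (a ∷ c) []      _               = z≤n
length-linComb (a ∷ c) (b ∷ B) (|b|≤k ∷ |B|≤k) =
  length-addP (scaleP a b) (linComb c B) (ℕₚ.≤-trans (ℕₚ.≤-reflexive (Listₚ.length-map (a ∧_) b)) |b|≤k)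
              (length-linComb c B |B|≤k)

nonzero-scaleP-false : ∀ p → nonzero (scaleP false p) ≡ false
nonzero-scaleP-false []      = refl
nonzero-scaleP-false (_ ∷ p) = nonzero-scaleP-false p

nonzero-addP-zeroˡ : ∀ p q → nonzero p ≡ false → nonzero (addP p q) ≡ nonzero q
nonzero-addP-zeroˡ []          q           _   = refl
nonzero-addP-zeroˡ (false ∷ p) []          p≡0 = p≡0
nonzero-addP-zeroˡ (false ∷ p) (false ∷ q) p≡0 = nonzero-addP-zeroˡ p q p≡0
nonzero-addP-zeroˡ (false ∷ p) (true ∷ q)  _   = refl

nonzero-linComb-zero : ∀ c B → nonzero c ≡ false → nonzero (linComb c B) ≡ false
nonzero-linComb-zero []          B       _   = refl
nonzero-linComb-zero (false ∷ c) []      _   = refl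
nonzero-linComb-zero (false ∷ c) (b ∷ B) c≡0 =
  trans (nonzero-addP-zeroˡ (scaleP false b) (linComb c B) (nonzero-scaleP-false b)) (nonzero-linComb-zero c B c≡0)

independent⇒nonzero-linComb : ∀ B → independent B ≡ true →
  All (λ c → nonzero (linComb c B) ≡ nonzero c) (vecs (length B))
independent⇒nonzero-linComb B B-ind = All.map (λ {c} → preserved c) (allᵇ⇒All _ (vecs (length B)) B-ind)
  where
  preserved : ∀ c → (if nonzero c then nonzero (linComb c B) else true) ≡ true → nonzero (linComb c B) ≡ nonzero c
  preserved c h with nonzero c in c≡
  ... | true  = h
  ... | false = nonzero-linComb-zero c B c≡

-- Double counting ∑_Y ∑_c (-1)^{c·(B Y)}: summing over c detects B Y = 0, summing over Y detects
-- c B = 0, which by independence means c = 0.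
kernel-count-independent : ∀ k B → RowsOfWidth≤ k B → independent B ≡ true →
  count (inKernel B) (vecs k) * 2 ^ length B ≡ 2 ^ k
kernel-count-independent k B |B|≤k B-ind = ℤₚ.+-injective (begin
  + (count (inKernel B) (vecs k) * 2 ^ r)
    ≡⟨ trans (ℤₚ.pos-* (count (inKernel B) (vecs k)) (2 ^ r))
             (ℤₚ.*-comm (+ count (inKernel B) (vecs k)) (+ 2 ^ r)) ⟩
  + (2 ^ r) ℤ.* + count (inKernel B) (vecs k)
    ≡⟨ sym (∑-if (inKernel B) (+ (2 ^ r)) (vecs k)) ⟩
  Σℤ.∑[ Y ∈ vecs k ] (if inKernel B Y then + (2 ^ r) else + 0)
    ≡⟨ Σℤ.∑-cong (vecs k) (λ Y → sym (kernel-indicator Y)) ⟩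
  Σℤ.∑[ Y ∈ vecs k ] Σℤ.∑[ c ∈ vecs r ] sign (c · (B ⊛ Y))
    ≡⟨ Σℤ.∑-comm (λ Y c → sign (c · (B ⊛ Y))) (vecs k) (vecs r) ⟩
  Σℤ.∑[ c ∈ vecs r ] Σℤ.∑[ Y ∈ vecs k ] sign (c · (B ⊛ Y))
    ≡⟨ Σℤ.∑-cong (vecs r) (λ c → Σℤ.∑-cong (vecs k) (λ Y →
         cong sign (trans (·-linComb c B Y) (·-comm (linComb c B) Y)))) ⟩
  Σℤ.∑[ c ∈ vecs r ] Σℤ.∑[ Y ∈ vecs k ] sign (Y · linComb c B)
    ≡⟨ Σℤ.∑-cong (vecs r) (λ c → character-sum k (linComb c B) (length-linComb c B |B|≤k)) ⟩
  Σℤ.∑[ c ∈ vecs r ] (if nonzero (linComb c B) then + 0 else + (2 ^ k))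
    ≡⟨ Σℤ.∑-cong-All (All.map (cong (λ b → if b then + 0 else + (2 ^ k))) (independent⇒nonzero-linComb B B-ind)) ⟩
  Σℤ.∑[ c ∈ vecs r ] (if nonzero c then + 0 else + (2 ^ k))
    ≡⟨ Σℤ.∑-vecs-δ r (+ (2 ^ k)) ⟩
  + (2 ^ k) ∎)
  where
  open ≡-Reasoning
  r : ℕ
  r = length B
  kernel-indicator : ∀ Y → Σℤ.∑[ c ∈ vecs r ] sign (c · (B ⊛ Y)) ≡ (if inKernel B Y then + (2 ^ r) else + 0)
  kernel-indicator Y = trans (character-sum r (B ⊛ Y) (ℕₚ.≤-reflexive (Listₚ.length-map (_· Y) B)))
                             (sym (if-not (nonzero (B ⊛ Y))))

inSpan : Row → List Row → Bool
inSpan x B = anyᵇ (λ c → not (nonzero (addP x (linComb c B)))) (vecs (length B))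

basis : List Row → List Row
basis []      = []
basis (x ∷ M) = if inSpan x (basis M) then basis M else x ∷ basis M

basis-⊆ : ∀ M → basis M ⊆ M
basis-⊆ []      = []
basis-⊆ (x ∷ M) with inSpan x (basis M)
... | true  = x ∷ʳ basis-⊆ M
... | false = refl ∷ basis-⊆ M

independent-∷ : ∀ x B → independent B ≡ true → inSpan x B ≡ false → independent (x ∷ B) ≡ true
independent-∷ x B B-ind x∉span = All⇒allᵇ _ (vecs (suc (length B))) (All-vecs-suc (length B)
  (All.map (λ {c} → leading-false c) (allᵇ⇒All _ (vecs (length B)) B-ind))
  (All.map (λ {c} → leading-true c) (anyᵇ≡false⇒All _ (vecs (length B)) x∉span)))
  where
  leading-false : ∀ c → (if nonzero c then nonzero (linComb c B) else true) ≡ true →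
    (if nonzero c then nonzero (addP (scaleP false x) (linComb c B)) else true) ≡ true
  leading-false c = trans (cong (λ b → if nonzero c then b else true)
    (nonzero-addP-zeroˡ (scaleP false x) (linComb c B) (nonzero-scaleP-false x)))
  leading-true : ∀ c → not (nonzero (addP x (linComb c B))) ≡ false →
    nonzero (addP (scaleP true x) (linComb c B)) ≡ true
  leading-true c x+cB≢0 =
    trans (cong (λ y → nonzero (addP y (linComb c B))) (Listₚ.map-id x)) (not-injective x+cB≢0)

basis-independent : ∀ M → independent (basis M) ≡ true
basis-independent []      = refl
basis-independent (x ∷ M) with inSpan x (basis M) in x∈span
... | true  = basis-independent M
... | false = independent-∷ x (basis M) (basis-independent M) x∈span

inSpan-orthogonal : ∀ x B Y → inSpan x B ≡ true → Y ∈Ker B → x · Y ≡ false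
inSpan-orthogonal x B Y x∈span Y∈ker with anyᵇ⇒∃ _ (vecs (length B)) x∈span
... | c , x+cB≡0 = begin
  x · Y                                ≡⟨ sym (xor-identityʳ (x · Y)) ⟩
  x · Y xor false                      ≡⟨ cong (x · Y xor_) (sym (·-zeroʳ c (B ⊛ Y) BY≡0)) ⟩
  x · Y xor c · (B ⊛ Y)                ≡⟨ cong (x · Y xor_) (·-linComb c B Y) ⟩
  x · Y xor linComb c B · Y            ≡⟨ sym (coeffT⁻¹-addP (ext Y) x (linComb c B)) ⟩
  addP x (linComb c B) · Y             ≡⟨ coeffT⁻¹-zeroᵖ (ext Y) (addP x (linComb c B)) x+cB≡0′ ⟩
  false                                ∎
  where
  open ≡-Reasoning
  BY≡0 : nonzero (B ⊛ Y) ≡ false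
  BY≡0 = Equivalence.from (nonzero≡false⇔ (B ⊛ Y)) (Allₚ.map⁺ Y∈ker)
  x+cB≡0′ : nonzero (addP x (linComb c B)) ≡ false
  x+cB≡0′ = Equivalence.to T-not-≡ (Equivalence.from T-≡ x+cB≡0)

∈Ker-basis⁻ : ∀ M Y → Y ∈Ker basis M → Y ∈Ker M
∈Ker-basis⁻ []      Y _       = []
∈Ker-basis⁻ (x ∷ M) Y Y∈ker with inSpan x (basis M) in x∈span
... | true  = inSpan-orthogonal x (basis M) Y x∈span Y∈ker ∷ ∈Ker-basis⁻ M Y Y∈ker
... | false with x·Y≡0 ∷ Y∈ker′ ← Y∈ker = x·Y≡0 ∷ ∈Ker-basis⁻ M Y Y∈ker′

inKernel-basis : ∀ M Y → inKernel (basis M) Y ≡ inKernel M Y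
inKernel-basis M Y = ⇔→≡ (⇔.trans (inKernel⇔∈Ker (basis M) Y)
  (⇔.trans (mk⇔ (∈Ker-basis⁻ M Y) (All-resp-⊆ (basis-⊆ M))) (⇔.sym (inKernel⇔∈Ker M Y))))

sublists-⊆ : ∀ (M : List B) → All (_⊆ M) (sublists M)
sublists-⊆ []      = [] ∷ []
sublists-⊆ (x ∷ M) = Allₚ.concat⁺ (Allₚ.map⁺ (All.map (λ s⊆M → (x ∷ʳ s⊆M) ∷ (refl ∷ s⊆M) ∷ []) (sublists-⊆ M)))

⊆⇒∈-sublists : ∀ {s M : List B} → s ⊆ M → s ∈ sublists M
⊆⇒∈-sublists []           = here refl
⊆⇒∈-sublists (y ∷ʳ s⊆M)   = Anyₚ.concatMap⁺ _ (Any.map here (⊆⇒∈-sublists s⊆M))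
⊆⇒∈-sublists (refl ∷ s⊆M) = Anyₚ.concatMap⁺ _ (Any.map (there ∘ here ∘ cong (_ ∷_)) (⊆⇒∈-sublists s⊆M))

≤-maxℕ-map : ∀ (f : B → ℕ) {x xs} → x ∈ xs → f x ≤ maxℕ (map f xs)
≤-maxℕ-map f (here refl)                = ℕₚ.m≤m⊔n _ _
≤-maxℕ-map f {xs = y ∷ _} (there x∈xs) = ℕₚ.≤-trans (≤-maxℕ-map f x∈xs) (ℕₚ.m≤n⊔m (f y) _)

maxℕ-map-≤ : ∀ (f : B → ℕ) {g} xs → (∀ {x} → x ∈ xs → f x ≤ g) → maxℕ (map f xs) ≤ g
maxℕ-map-≤ f []       _     = z≤n
maxℕ-map-≤ f (x ∷ xs) bound = ℕₚ.⊔-lub (bound (here refl)) (maxℕ-map-≤ f xs (bound ∘ there))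

2^-cancel-≤ : ∀ {a b} → 2 ^ a ≤ 2 ^ b → a ≤ b
2^-cancel-≤ 2^a≤2^b = ℕₚ.≮⇒≥ (λ b<a → ℕₚ.<⇒≱ (ℕₚ.^-monoʳ-< 2 (s≤s (s≤s z≤n)) b<a) 2^a≤2^b)

cofactor-of-2^ : ∀ c r k → c * 2 ^ r ≡ 2 ^ k → r ≤ k × c ≡ 2 ^ (k ∸ r)
cofactor-of-2^ zero    r k 0≡2^k = ⊥-elim (ℕₚ.<⇒≢ (ℕₚ.m^n>0 2 k) 0≡2^k)
cofactor-of-2^ (suc c) r k c2^r≡2^k =
  r≤k , ℕₚ.*-cancelʳ-≡ (suc c) (2 ^ (k ∸ r)) (2 ^ r) {{ℕₚ.m^n≢0 2 r}} (begin
  suc c * 2 ^ r        ≡⟨ c2^r≡2^k ⟩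
  2 ^ k                ≡⟨ cong (2 ^_) (sym (ℕₚ.m∸n+n≡m r≤k)) ⟩
  2 ^ (k ∸ r + r)      ≡⟨ ℕₚ.^-distribˡ-+-* 2 (k ∸ r) r ⟩
  2 ^ (k ∸ r) * 2 ^ r  ∎)
  where
  open ≡-Reasoning
  r≤k : r ≤ k
  r≤k = 2^-cancel-≤ (ℕₚ.≤-trans (ℕₚ.m≤n*m (2 ^ r) (suc c)) (ℕₚ.≤-reflexive c2^r≡2^k))

-- ker (basis M) = ker M ⊆ ker s, and these kernels have 2^{k - length (basis M)} and
-- 2^{k - length s} elements.
independent-sublist-length : ∀ k M s → RowsOfWidth≤ k M → s ⊆ M → independent s ≡ true →
  length s ≤ length (basis M)
independent-sublist-length k M s M-width s⊆M s-ind = ℕₚ.∸-cancelʳ-≤ |s|≤k (2^-cancel-≤ (begin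
  2 ^ (k ∸ length (basis M))              ≡⟨ sym basis-kernel ⟩
  count (inKernel (basis M)) (vecs k)     ≤⟨ count-mono _ _ (vecs k) basis-kernel⊆s-kernel ⟩
  count (inKernel s) (vecs k)             ≡⟨ s-kernel ⟩
  2 ^ (k ∸ length s)                      ∎))
  where
  open ℕₚ.≤-Reasoning
  basis-kernel : count (inKernel (basis M)) (vecs k) ≡ 2 ^ (k ∸ length (basis M))
  basis-kernel = proj₂ (cofactor-of-2^ _ (length (basis M)) k
    (kernel-count-independent k (basis M) (All-resp-⊆ (basis-⊆ M) M-width) (basis-independent M)))
  s-count : length s ≤ k × count (inKernel s) (vecs k) ≡ 2 ^ (k ∸ length s)
  s-count = cofactor-of-2^ _ (length s) k (kernel-count-independent k s (All-resp-⊆ s⊆M M-width) s-ind)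
  |s|≤k : length s ≤ k
  |s|≤k = proj₁ s-count
  s-kernel : count (inKernel s) (vecs k) ≡ 2 ^ (k ∸ length s)
  s-kernel = proj₂ s-count
  basis-kernel⊆s-kernel : ∀ Y → inKernel (basis M) Y ≡ true → inKernel s Y ≡ true
  basis-kernel⊆s-kernel Y Y∈ker = Equivalence.from (inKernel⇔∈Ker s Y)
    (All-resp-⊆ s⊆M (Equivalence.to (inKernel⇔∈Ker M Y) (trans (sym (inKernel-basis M Y)) Y∈ker)))

rank≡length-basis : ∀ k M → RowsOfWidth≤ k M → rank M ≡ length (basis M)
rank≡length-basis k M M-width = ℕₚ.≤-antisym
  (maxℕ-map-≤ length (filterᵇ independent (sublists M)) (λ s∈ →
    let s∈sublists , s-ind = ∈-filter⁻ (T? ∘ independent) s∈ in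
    independent-sublist-length k M _ M-width (All.lookup (sublists-⊆ M) s∈sublists) (Equivalence.to T-≡ s-ind)))
  (≤-maxℕ-map length (∈-filter⁺ (T? ∘ independent) (⊆⇒∈-sublists (basis-⊆ M))
                                                   (Equivalence.from T-≡ (basis-independent M))))

kernel-count : ∀ k M → RowsOfWidth≤ k M → count (inKernel M) (vecs k) * 2 ^ rank M ≡ 2 ^ k
kernel-count k M M-width =
  trans (cong₂ _*_ (count-cong (vecs k) (sym ∘ inKernel-basis M))
                   (cong (2 ^_) (rank≡length-basis k M M-width)))
        (kernel-count-independent k (basis M) (All-resp-⊆ (basis-⊆ M) M-width) (basis-independent M))

rank≤width : ∀ k M → RowsOfWidth≤ k M → rank M ≤ k
rank≤width k M M-width =
  proj₁ (cofactor-of-2^ (count (inKernel M) (vecs k)) (rank M) k (kernel-count k M M-width))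

rank≤height : ∀ k M → RowsOfWidth≤ k M → rank M ≤ length M
rank≤height k M M-width =
  subst (_≤ length M) (sym (rank≡length-basis k M M-width)) (Sublistₚ.length-mono-≤ (basis-⊆ M))

length-map-upTo : ∀ (s : ℕ → B) k → length (map s (upTo k)) ≡ k
length-map-upTo s k = trans (Listₚ.length-map s (upTo k)) (Listₚ.length-upTo k)

·-row : ∀ s {k} Y → length Y ≡ k → map s (upTo k) · Y ≡ coeffT⁻¹ s Y
·-row s {k} Y |Y|≡k = trans (·-comm (map s (upTo k)) Y) (·-prefix s Y (ℕₚ.≤-reflexive |Y|≡k))

∑-E-mulP : ∀ t n Y → Σℤ.∑[ Z ∈ vecs n ] E t (mulP Y Z)
  ≡ (if nonzero (map (λ i → coeffT⁻¹ (shiftBy i t) Y) (upTo n)) then + 0 else + (2 ^ n))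
∑-E-mulP t n Y = trans
  (Σℤ.∑-cong-vecs n (λ Z |Z|≡n →
    cong sign (trans (coeffT⁻¹-mulP t Y Z) (sym (·-prefix w Z (ℕₚ.≤-reflexive |Z|≡n))))))
  (character-sum n (map w (upTo n)) (ℕₚ.≤-reflexive (length-map-upTo w n)))
  where
  w : ℕ → Bool
  w i = coeffT⁻¹ (shiftBy i t) Y

D⊛ : ∀ m k t η Y → length Y ≡ k →
  D m k t η ⊛ Y ≡ map (λ i → coeffT⁻¹ (shiftBy i t) Y) (upTo (suc m)) ++ coeffT⁻¹ η Y ∷ []
D⊛ m k t η Y |Y|≡k = begin
  map (_· Y) (map (λ i → map (shiftBy i t) (upTo k)) (upTo (suc m)) ++ map η (upTo k) ∷ [])
    ≡⟨ Listₚ.map-++ (_· Y) (map (λ i → map (shiftBy i t) (upTo k)) (upTo (suc m))) _ ⟩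
  map (_· Y) (map (λ i → map (shiftBy i t) (upTo k)) (upTo (suc m))) ++ map η (upTo k) · Y ∷ []
    ≡⟨ cong₂ (λ xs x → xs ++ x ∷ [])
             (trans (sym (Listₚ.map-∘ (upTo (suc m))))
                    (Listₚ.map-cong (λ i → ·-row (shiftBy i t) Y |Y|≡k) (upTo (suc m))))
             (·-row η Y |Y|≡k) ⟩
  map (λ i → coeffT⁻¹ (shiftBy i t) Y) (upTo (suc m)) ++ coeffT⁻¹ η Y ∷ [] ∎
  where open ≡-Reasoning

nonzero-∷ʳ : ∀ w b → nonzero (w ++ b ∷ []) ≡ nonzero w ∨ b
nonzero-∷ʳ []          false = refl
nonzero-∷ʳ []          true  = refl
nonzero-∷ʳ (false ∷ w) b     = nonzero-∷ʳ w b
nonzero-∷ʳ (true ∷ w)  b     = refl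

f-summand : ∀ m k t η Y → length Y ≡ k →
  Σℤ.∑[ Z ∈ polysDegLe m ] E t (mulP Y Z) ℤ.* Σℤ.∑[ U ∈ polysDegLe 0 ] E η (mulP Y U)
    ≡ (if inKernel (D m k t η) Y then + (2 ^ (2 + m)) else + 0)
f-summand m k t η Y |Y|≡k = begin
  Σℤ.∑[ Z ∈ polysDegLe m ] E t (mulP Y Z) ℤ.* Σℤ.∑[ U ∈ polysDegLe 0 ] E η (mulP Y U)
    ≡⟨ cong₂ ℤ._*_ (∑-E-mulP t (suc m) Y) (∑-E-mulP η 1 Y) ⟩
  (if nonzero w then + 0 else + (2 ^ suc m)) ℤ.* (if nonzero (b ∷ []) then + 0 else + 2)
    ≡⟨ product (nonzero w) b ⟩
  (if not (nonzero w ∨ b) then + (2 ^ (2 + m)) else + 0)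
    ≡⟨ cong (λ x → if not x then + (2 ^ (2 + m)) else + 0)
            (sym (trans (cong nonzero (D⊛ m k t η Y |Y|≡k)) (nonzero-∷ʳ w b))) ⟩
  (if inKernel (D m k t η) Y then + (2 ^ (2 + m)) else + 0) ∎
  where
  open ≡-Reasoning
  w : List Bool
  w = map (λ i → coeffT⁻¹ (shiftBy i t) Y) (upTo (suc m))
  b : Bool
  b = coeffT⁻¹ η Y
  product : ∀ x y → (if x then + 0 else + (2 ^ suc m)) ℤ.* (if nonzero (y ∷ []) then + 0 else + 2)
                    ≡ (if not (x ∨ y) then + (2 ^ (2 + m)) else + 0)
  product true  y     = refl
  product false true  = ℤₚ.*-zeroʳ (+ (2 ^ suc m))
  product false false = trans (sym (ℤₚ.pos-* (2 ^ suc m) 2)) (cong +_ (ℕₚ.*-comm (2 ^ suc m) 2))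

D-width : ∀ m k t η → RowsOfWidth≤ k (D m k t η)
D-width m k t η = Allₚ.++⁺
  (Allₚ.map⁺ (All.universal (λ i → ℕₚ.≤-reflexive (length-map-upTo (shiftBy i t) k)) (upTo (suc m))))
  (ℕₚ.≤-reflexive (length-map-upTo η k) ∷ [])

f≡2^ : ∀ m k t η → f m k t η ≡ + (2 ^ (k + m + 2 ∸ rank (D m k t η)))
f≡2^ m k t η = begin
  f m k t η
    ≡⟨ Σℤ.∑-cong-vecs k (f-summand m k t η) ⟩
  Σℤ.∑[ Y ∈ vecs k ] (if inKernel (D m k t η) Y then + (2 ^ (2 + m)) else + 0)
    ≡⟨ ∑-if (inKernel (D m k t η)) (+ (2 ^ (2 + m))) (vecs k) ⟩
  + (2 ^ (2 + m)) ℤ.* + count (inKernel (D m k t η)) (vecs k)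
    ≡⟨ cong (λ c → + (2 ^ (2 + m)) ℤ.* + c) (proj₂ kernel) ⟩
  + (2 ^ (2 + m)) ℤ.* + (2 ^ (k ∸ r))
    ≡⟨ sym (ℤₚ.pos-* (2 ^ (2 + m)) (2 ^ (k ∸ r))) ⟩
  + (2 ^ (2 + m) * 2 ^ (k ∸ r))
    ≡⟨ cong +_ (sym (ℕₚ.^-distribˡ-+-* 2 (2 + m) (k ∸ r))) ⟩
  + (2 ^ (2 + m + (k ∸ r)))
    ≡⟨ cong (λ e → + (2 ^ e)) exponent ⟩
  + (2 ^ (k + m + 2 ∸ r)) ∎
  where
  open ≡-Reasoning
  r : ℕ
  r = rank (D m k t η)
  kernel : r ≤ k × count (inKernel (D m k t η)) (vecs k) ≡ 2 ^ (k ∸ r)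
  kernel = cofactor-of-2^ _ r k (kernel-count k (D m k t η) (D-width m k t η))
  exponent : 2 + m + (k ∸ r) ≡ k + m + 2 ∸ r
  exponent = trans (sym (ℕₚ.+-∸-assoc (2 + m) (proj₁ kernel))) (cong (_∸ r) (shuffle k m))
    where
    shuffle : ∀ k m → 2 + m + k ≡ k + m + 2
    shuffle = ℕ-Solver.solve-∀

module Σℚ = FiniteSums ℚₚ.+-*-isCommutativeRing

ℚ-ring : AlmostCommutativeRing 0ℓ 0ℓ
ℚ-ring = fromCommutativeRing ℚₚ.+-*-commutativeRing (λ _ → nothing)

ι : ℕ → ℚ
ι n = + n ℚ./ 1

-- The normal form of ι n, on which the arithmetic of ℚ computes
ι≡mkℚ : ∀ n → ι n ≡ ℚ.mkℚ (+ n) 0 (Coprime.sym (Coprime.1-coprimeTo n))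
ι≡mkℚ n = ℚₚ.↥p/↧p≡p (ℚ.mkℚ (+ n) 0 (Coprime.sym (Coprime.1-coprimeTo n)))

ι-+ : ∀ a b → ι (a + b) ≡ ι a ℚ.+ ι b
ι-+ a b rewrite ι≡mkℚ a | ι≡mkℚ b =
  cong (ℚ._/ 1) (sym (cong₂ ℤ._+_ (ℤₚ.*-identityʳ (+ a)) (ℤₚ.*-identityʳ (+ b))))

ι-* : ∀ a b → ι (a * b) ≡ ι a ℚ.* ι b
ι-* a b rewrite ι≡mkℚ a | ι≡mkℚ b = cong (ℚ._/ 1) (ℤₚ.pos-* a b)

ι-2^ : ∀ n → ι (2 ^ n) ≡ pow2ℕ n
ι-2^ zero    = refl
ι-2^ (suc n) = trans (ι-* 2 (2 ^ n)) (cong ((ℚ.1ℚ ℚ.+ ℚ.1ℚ) ℚ.*_) (ι-2^ n))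

ι-sumℕ : ∀ (g : B → ℕ) xs → ι (sumℕ (map g xs)) ≡ Σℚ.∑[ x ∈ xs ] ι (g x)
ι-sumℕ g []       = refl
ι-sumℕ g (x ∷ xs) = trans (ι-+ (g x) _) (cong (ι (g x) ℚ.+_) (ι-sumℕ g xs))

ι-count : ∀ (p : B → Bool) xs → ι (count p xs) ≡ Σℚ.∑[ x ∈ xs ] (if p x then ℚ.1ℚ else ℚ.0ℚ)
ι-count p []       = refl
ι-count p (x ∷ xs) with p x
... | true  = trans (ι-+ 1 (count p xs)) (cong (ℚ.1ℚ ℚ.+_) (ι-count p xs))
... | false = trans (ι-count p xs) (sym (ℚₚ.+-identityˡ _))

∑-upTo-δ : ∀ M r (h : ℕ → ℚ) → r < M →
  Σℚ.∑[ i ∈ upTo M ] ((if r ≡ᵇ i then ℚ.1ℚ else ℚ.0ℚ) ℚ.* h i) ≡ h r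
∑-upTo-δ (suc M) zero    h _ = begin
  Σℚ.∑[ i ∈ upTo (suc M) ] ((if 0 ≡ᵇ i then ℚ.1ℚ else ℚ.0ℚ) ℚ.* h i)
    ≡⟨ Σℚ.∑-upTo-suc M (λ i → (if 0 ≡ᵇ i then ℚ.1ℚ else ℚ.0ℚ) ℚ.* h i) ⟩
  ℚ.1ℚ ℚ.* h 0 ℚ.+ Σℚ.∑[ i ∈ upTo M ] (ℚ.0ℚ ℚ.* h (suc i))
    ≡⟨ cong₂ ℚ._+_ (ℚₚ.*-identityˡ (h 0))
                   (trans (Σℚ.∑-cong (upTo M) (λ i → ℚₚ.*-zeroˡ (h (suc i)))) (Σℚ.∑-0# (upTo M))) ⟩
  h 0 ℚ.+ ℚ.0ℚ
    ≡⟨ ℚₚ.+-identityʳ (h 0) ⟩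
  h 0 ∎
  where open ≡-Reasoning
∑-upTo-δ (suc M) (suc r) h (s≤s r<M) = begin
  Σℚ.∑[ i ∈ upTo (suc M) ] ((if suc r ≡ᵇ i then ℚ.1ℚ else ℚ.0ℚ) ℚ.* h i)
    ≡⟨ Σℚ.∑-upTo-suc M (λ i → (if suc r ≡ᵇ i then ℚ.1ℚ else ℚ.0ℚ) ℚ.* h i) ⟩
  ℚ.0ℚ ℚ.* h 0 ℚ.+ Σℚ.∑[ i ∈ upTo M ] ((if r ≡ᵇ i then ℚ.1ℚ else ℚ.0ℚ) ℚ.* h (suc i))
    ≡⟨ cong₂ ℚ._+_ (ℚₚ.*-zeroˡ (h 0)) (∑-upTo-δ M r (h ∘ suc) r<M) ⟩
  ℚ.0ℚ ℚ.+ h (suc r)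
    ≡⟨ ℚₚ.+-identityˡ (h (suc r)) ⟩
  h (suc r) ∎
  where open ≡-Reasoning

∑-fibres : ∀ (r : B → ℕ) (h : ℕ → ℚ) M xs → All (λ x → r x < M) xs →
  Σℚ.∑[ i ∈ upTo M ] (ι (count (λ x → r x ≡ᵇ i) xs) ℚ.* h i) ≡ Σℚ.∑[ x ∈ xs ] h (r x)
∑-fibres {B} r h M xs r<M = begin
  Σℚ.∑[ i ∈ upTo M ] (ι (count (λ x → r x ≡ᵇ i) xs) ℚ.* h i)
    ≡⟨ Σℚ.∑-cong (upTo M) (λ i → cong (ℚ._* h i) (ι-count (λ x → r x ≡ᵇ i) xs)) ⟩
  Σℚ.∑[ i ∈ upTo M ] (Σℚ.∑[ x ∈ xs ] δ x i ℚ.* h i)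
    ≡⟨ Σℚ.∑-cong (upTo M) (λ i → sym (Σℚ.∑-⊗ʳ (h i) (λ x → δ x i) xs)) ⟩
  Σℚ.∑[ i ∈ upTo M ] Σℚ.∑[ x ∈ xs ] (δ x i ℚ.* h i)
    ≡⟨ Σℚ.∑-comm (λ i x → δ x i ℚ.* h i) (upTo M) xs ⟩
  Σℚ.∑[ x ∈ xs ] Σℚ.∑[ i ∈ upTo M ] (δ x i ℚ.* h i)
    ≡⟨ Σℚ.∑-cong-All (All.map (∑-upTo-δ M _ h) r<M) ⟩
  Σℚ.∑[ x ∈ xs ] h (r x) ∎
  where
  open ≡-Reasoning
  δ : B → ℕ → ℚ
  δ x i = if r x ≡ᵇ i then ℚ.1ℚ else ℚ.0ℚ

pow2ℕ-+ : ∀ a b → pow2ℕ (a + b) ≡ pow2ℕ a ℚ.* pow2ℕ b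
pow2ℕ-+ zero    b = sym (ℚₚ.*-identityˡ _)
pow2ℕ-+ (suc a) b =
  trans (cong ((ℚ.1ℚ ℚ.+ ℚ.1ℚ) ℚ.*_) (pow2ℕ-+ a b)) (sym (ℚₚ.*-assoc (ℚ.1ℚ ℚ.+ ℚ.1ℚ) (pow2ℕ a) (pow2ℕ b)))

halfPow-+ : ∀ a b → halfPow (a + b) ≡ halfPow a ℚ.* halfPow b
halfPow-+ zero    b = sym (ℚₚ.*-identityˡ _)
halfPow-+ (suc a) b = trans (cong (ℚ.½ ℚ.*_) (halfPow-+ a b)) (sym (ℚₚ.*-assoc ℚ.½ (halfPow a) (halfPow b)))

pow2ℕ*halfPow : ∀ n → pow2ℕ n ℚ.* halfPow n ≡ ℚ.1ℚ
pow2ℕ*halfPow zero    = refl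
pow2ℕ*halfPow (suc n) =
  trans (interchange (ℚ.1ℚ ℚ.+ ℚ.1ℚ) (pow2ℕ n) ℚ.½ (halfPow n)) (cong (ℚ.1ℚ ℚ.*_) (pow2ℕ*halfPow n))
  where
  interchange : ∀ a b c d → (a ℚ.* b) ℚ.* (c ℚ.* d) ≡ (a ℚ.* c) ℚ.* (b ℚ.* d)
  interchange = solve-∀ ℚ-ring

pow2ℕ-split : ∀ a b → pow2ℕ a ≡ pow2ℕ (a + b) ℚ.* halfPow b
pow2ℕ-split a b = sym (begin
  pow2ℕ (a + b) ℚ.* halfPow b              ≡⟨ cong (ℚ._* halfPow b) (pow2ℕ-+ a b) ⟩
  (pow2ℕ a ℚ.* pow2ℕ b) ℚ.* halfPow b      ≡⟨ ℚₚ.*-assoc (pow2ℕ a) (pow2ℕ b) (halfPow b) ⟩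
  pow2ℕ a ℚ.* (pow2ℕ b ℚ.* halfPow b)      ≡⟨ cong (pow2ℕ a ℚ.*_) (pow2ℕ*halfPow b) ⟩
  pow2ℕ a ℚ.* ℚ.1ℚ                         ≡⟨ ℚₚ.*-identityʳ (pow2ℕ a) ⟩
  pow2ℕ a                                  ∎)
  where open ≡-Reasoning

pow2-neg : ∀ n → pow2 (ℤ.- (+ n)) ≡ halfPow n
pow2-neg zero    = refl
pow2-neg (suc n) = refl

pow2-⊖ : ∀ a b → pow2 (+ a ℤ.- + b) ≡ pow2ℕ a ℚ.* halfPow b
pow2-⊖ a b with b ≤? a
... | yes b≤a = begin
  pow2 (+ a ℤ.- + b)                   ≡⟨ cong pow2 (trans (ℤₚ.m-n≡m⊖n a b) (ℤₚ.⊖-≥ b≤a)) ⟩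
  pow2ℕ (a ∸ b)                        ≡⟨ pow2ℕ-split (a ∸ b) b ⟩
  pow2ℕ (a ∸ b + b) ℚ.* halfPow b      ≡⟨ cong (λ e → pow2ℕ e ℚ.* halfPow b) (ℕₚ.m∸n+n≡m b≤a) ⟩
  pow2ℕ a ℚ.* halfPow b                ∎
  where open ≡-Reasoning
... | no b≰a = begin
  pow2 (+ a ℤ.- + b)                              ≡⟨ cong pow2 (trans (ℤₚ.m-n≡m⊖n a b) (ℤₚ.⊖-< a<b)) ⟩
  pow2 (ℤ.- (+ (b ∸ a)))                          ≡⟨ pow2-neg (b ∸ a) ⟩
  halfPow (b ∸ a)                                 ≡⟨ sym (ℚₚ.*-identityˡ _) ⟩
  ℚ.1ℚ ℚ.* halfPow (b ∸ a)                        ≡⟨ cong (ℚ._* halfPow (b ∸ a)) (sym (pow2ℕ*halfPow a)) ⟩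
  (pow2ℕ a ℚ.* halfPow a) ℚ.* halfPow (b ∸ a)     ≡⟨ ℚₚ.*-assoc (pow2ℕ a) (halfPow a) (halfPow (b ∸ a)) ⟩
  pow2ℕ a ℚ.* (halfPow a ℚ.* halfPow (b ∸ a))     ≡⟨ cong (pow2ℕ a ℚ.*_) (sym (halfPow-+ a (b ∸ a))) ⟩
  pow2ℕ a ℚ.* halfPow (a + (b ∸ a))               ≡⟨ cong (λ e → pow2ℕ a ℚ.* halfPow e) (ℕₚ.m+[n∸m]≡n (ℕₚ.<⇒≤ a<b)) ⟩
  pow2ℕ a ℚ.* halfPow b                           ∎
  where
  open ≡-Reasoning
  a<b : a < b
  a<b = ℕₚ.≰⇒> b≰a

pos-^ : ∀ x n → (+ x) ℤ.^ n ≡ + (x ^ n)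
pos-^ x zero    = refl
pos-^ x (suc n) = trans (cong (+ x ℤ.*_) (pos-^ x n)) (sym (ℤₚ.pos-* x (x ^ n)))

∑-vecs-const : ∀ d (c : ℚ) → Σℚ.∑[ _ ∈ vecs d ] c ≡ pow2ℕ d ℚ.* c
∑-vecs-const zero    c = trans (ℚₚ.+-identityʳ c) (sym (ℚₚ.*-identityˡ c))
∑-vecs-const (suc d) c = begin
  Σℚ.∑[ _ ∈ vecs (suc d) ] c                      ≡⟨ Σℚ.∑-vecs-suc d (λ _ → c) ⟩
  Σℚ.∑[ _ ∈ vecs d ] (c ℚ.+ c)                    ≡⟨ Σℚ.∑-cong (vecs d) (λ _ → double c) ⟩
  Σℚ.∑[ _ ∈ vecs d ] ((ℚ.1ℚ ℚ.+ ℚ.1ℚ) ℚ.* c)      ≡⟨ Σℚ.∑-⊗ˡ (ℚ.1ℚ ℚ.+ ℚ.1ℚ) (λ _ → c) (vecs d) ⟩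
  (ℚ.1ℚ ℚ.+ ℚ.1ℚ) ℚ.* Σℚ.∑[ _ ∈ vecs d ] c        ≡⟨ cong ((ℚ.1ℚ ℚ.+ ℚ.1ℚ) ℚ.*_) (∑-vecs-const d c) ⟩
  (ℚ.1ℚ ℚ.+ ℚ.1ℚ) ℚ.* (pow2ℕ d ℚ.* c)             ≡⟨ sym (ℚₚ.*-assoc (ℚ.1ℚ ℚ.+ ℚ.1ℚ) (pow2ℕ d) c) ⟩
  pow2ℕ (suc d) ℚ.* c                             ∎
  where
  open ≡-Reasoning
  double : ∀ c → c ℚ.+ c ≡ (ℚ.1ℚ ℚ.+ ℚ.1ℚ) ℚ.* c
  double = solve-∀ ℚ-ring

∑-vecs-local : ∀ n d (G : List Bool → ℚ) → (∀ u v → length u ≡ n → G (u ++ v) ≡ G u) →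
  Σℚ.∑ (vecs (n + d)) G ≡ pow2ℕ d ℚ.* Σℚ.∑ (vecs n) G
∑-vecs-local n d G G-local = begin
  Σℚ.∑ (vecs (n + d)) G
    ≡⟨ Σℚ.∑-vecs-+ n d G ⟩
  Σℚ.∑[ u ∈ vecs n ] Σℚ.∑[ v ∈ vecs d ] G (u ++ v)
    ≡⟨ Σℚ.∑-cong-vecs n (λ u |u|≡n → Σℚ.∑-cong (vecs d) (λ v → G-local u v |u|≡n)) ⟩
  Σℚ.∑[ u ∈ vecs n ] Σℚ.∑[ _ ∈ vecs d ] G u
    ≡⟨ Σℚ.∑-cong (vecs n) (λ u → ∑-vecs-const d (G u)) ⟩
  Σℚ.∑[ u ∈ vecs n ] (pow2ℕ d ℚ.* G u)
    ≡⟨ Σℚ.∑-⊗ˡ (pow2ℕ d) G (vecs n) ⟩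
  pow2ℕ d ℚ.* Σℚ.∑ (vecs n) G ∎
  where open ≡-Reasoning

ext-++ : ∀ u v {i} → i < length u → ext (u ++ v) i ≡ ext u i
ext-++ (b ∷ u) v {zero}  _         = refl
ext-++ (b ∷ u) v {suc i} (s≤s i<u) = ext-++ u v i<u

Cylinder : ℕ → ℕ → (ℙ → ℙ → B) → Set
Cylinder n₁ n₂ F = ∀ {t t′ η η′} → (∀ i → i < n₁ → t i ≡ t′ i) → (∀ j → j < n₂ → η j ≡ η′ j) → F t η ≡ F t′ η′

ext-++-agrees : ∀ {n} u v → length u ≡ n → ∀ i → i < n → ext (u ++ v) i ≡ ext u i
ext-++-agrees u v |u|≡n i i<n = ext-++ u v (subst (i <_) (sym |u|≡n) i<n)

integral-cylinder : ∀ n₁ n₂ d₁ d₂ (F : ℙ → ℙ → ℚ) → Cylinder n₁ n₂ F →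
  integralℙ² (n₁ + d₁) (n₂ + d₂) F ≡ (Σℚ.∑[ a ∈ vecs n₁ ] Σℚ.∑[ b ∈ vecs n₂ ] F (ext a) (ext b)) ℚ.* halfPow (n₁ + n₂)
integral-cylinder n₁ n₂ d₁ d₂ F F-cylinder = begin
  (Σℚ.∑[ a ∈ vecs (n₁ + d₁) ] Σℚ.∑[ b ∈ vecs (n₂ + d₂) ] F (ext a) (ext b)) ℚ.* halfPow (n₁ + d₁ + (n₂ + d₂))
    ≡⟨ cong₂ ℚ._*_ sums (cong halfPow (shuffle n₁ d₁ n₂ d₂)) ⟩
  pow2ℕ d₂ ℚ.* (pow2ℕ d₁ ℚ.* S) ℚ.* halfPow ((n₁ + n₂) + (d₁ + d₂))
    ≡⟨ cong (pow2ℕ d₂ ℚ.* (pow2ℕ d₁ ℚ.* S) ℚ.*_)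
            (trans (halfPow-+ (n₁ + n₂) (d₁ + d₂)) (cong (halfPow (n₁ + n₂) ℚ.*_) (halfPow-+ d₁ d₂))) ⟩
  pow2ℕ d₂ ℚ.* (pow2ℕ d₁ ℚ.* S) ℚ.* (halfPow (n₁ + n₂) ℚ.* (halfPow d₁ ℚ.* halfPow d₂))
    ≡⟨ rearrange (pow2ℕ d₂) (pow2ℕ d₁) S (halfPow (n₁ + n₂)) (halfPow d₁) (halfPow d₂) ⟩
  S ℚ.* halfPow (n₁ + n₂) ℚ.* ((pow2ℕ d₁ ℚ.* halfPow d₁) ℚ.* (pow2ℕ d₂ ℚ.* halfPow d₂))
    ≡⟨ cong (S ℚ.* halfPow (n₁ + n₂) ℚ.*_) (cong₂ ℚ._*_ (pow2ℕ*halfPow d₁) (pow2ℕ*halfPow d₂)) ⟩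
  S ℚ.* halfPow (n₁ + n₂) ℚ.* ℚ.1ℚ
    ≡⟨ ℚₚ.*-identityʳ _ ⟩
  S ℚ.* halfPow (n₁ + n₂) ∎
  where
  open ≡-Reasoning
  G : List Bool → ℚ
  G a = Σℚ.∑[ b ∈ vecs n₂ ] F (ext a) (ext b)
  S : ℚ
  S = Σℚ.∑ (vecs n₁) G
  sums : Σℚ.∑[ a ∈ vecs (n₁ + d₁) ] Σℚ.∑[ b ∈ vecs (n₂ + d₂) ] F (ext a) (ext b)
       ≡ pow2ℕ d₂ ℚ.* (pow2ℕ d₁ ℚ.* S)
  sums = begin
    Σℚ.∑[ a ∈ vecs (n₁ + d₁) ] Σℚ.∑[ b ∈ vecs (n₂ + d₂) ] F (ext a) (ext b)
      ≡⟨ Σℚ.∑-cong (vecs (n₁ + d₁)) (λ a → ∑-vecs-local n₂ d₂ _ (λ u v |u|≡n₂ →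
           F-cylinder (λ _ _ → refl) (ext-++-agrees u v |u|≡n₂))) ⟩
    Σℚ.∑[ a ∈ vecs (n₁ + d₁) ] (pow2ℕ d₂ ℚ.* G a)
      ≡⟨ Σℚ.∑-⊗ˡ (pow2ℕ d₂) G (vecs (n₁ + d₁)) ⟩
    pow2ℕ d₂ ℚ.* Σℚ.∑ (vecs (n₁ + d₁)) G
      ≡⟨ cong (pow2ℕ d₂ ℚ.*_) (∑-vecs-local n₁ d₁ G (λ u v |u|≡n₁ →
           Σℚ.∑-cong (vecs n₂) (λ b → F-cylinder (ext-++-agrees u v |u|≡n₁) (λ _ _ → refl)))) ⟩
    pow2ℕ d₂ ℚ.* (pow2ℕ d₁ ℚ.* S) ∎
  shuffle : ∀ n₁ d₁ n₂ d₂ → n₁ + d₁ + (n₂ + d₂) ≡ (n₁ + n₂) + (d₁ + d₂)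
  shuffle = ℕ-Solver.solve-∀
  rearrange : ∀ p₂ p₁ s h h₁ h₂ →
    p₂ ℚ.* (p₁ ℚ.* s) ℚ.* (h ℚ.* (h₁ ℚ.* h₂)) ≡ s ℚ.* h ℚ.* ((p₁ ℚ.* h₁) ℚ.* (p₂ ℚ.* h₂))
  rearrange = solve-∀ ℚ-ring

D-height : ∀ m k t η → length (D m k t η) ≡ 2 + m
D-height m k t η = begin
  length (map (λ i → map (shiftBy i t) (upTo k)) (upTo (suc m)) ++ map η (upTo k) ∷ [])
    ≡⟨ Listₚ.length-++ (map (λ i → map (shiftBy i t) (upTo k)) (upTo (suc m))) ⟩
  length (map (λ i → map (shiftBy i t) (upTo k)) (upTo (suc m))) + 1
    ≡⟨ cong (_+ 1) (length-map-upTo (λ i → map (shiftBy i t) (upTo k)) (suc m)) ⟩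
  suc m + 1
    ≡⟨ ℕₚ.+-comm (suc m) 1 ⟩
  2 + m ∎
  where open ≡-Reasoning

rank-D : ∀ m k t η → rank (D m k t η) < suc (k ⊓ (2 + m))
rank-D m k t η = s≤s (ℕₚ.⊓-glb (rank≤width k (D m k t η) (D-width m k t η))
  (subst (rank (D m k t η) ≤_) (D-height m k t η) (rank≤height k (D m k t η) (D-width m k t η))))

D-cylinder : ∀ m k → Cylinder (k + m) k (D m k)
D-cylinder m k {t} {t′} {η} {η′} t≈t′ η≈η′ = cong₂ (λ rows last → rows ++ last ∷ [])
  (Listₚ.map-cong-local (Allₚ.applyUpTo⁺₁ id (suc m) (λ { (s≤s i≤m) → row i≤m })))
  (Listₚ.map-cong-local (Allₚ.applyUpTo⁺₁ id k (η≈η′ _)))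
  where
  row : ∀ {i} → i ≤ m → map (shiftBy i t) (upTo k) ≡ map (shiftBy i t′) (upTo k)
  row {i} i≤m = Listₚ.map-cong-local (Allₚ.applyUpTo⁺₁ id k (λ {j} j<k →
    t≈t′ (i + j) (subst (i + j <_) (ℕₚ.+-comm m k) (ℕₚ.+-mono-≤-< i≤m j<k))))

integrand-value : ∀ m k q t η →
  ℤ._^_ (f m k t η) q ℚ./ 1 ≡ pow2ℕ (q * (k + m + 2)) ℚ.* halfPow (rank (D m k t η) * q)
integrand-value m k q t η = begin
  ℤ._^_ (f m k t η) q ℚ./ 1                        ≡⟨ cong (λ z → ℤ._^_ z q ℚ./ 1) (f≡2^ m k t η) ⟩
  ℤ._^_ (+ (2 ^ (e ∸ r))) q ℚ./ 1                  ≡⟨ cong (ℚ._/ 1) (pos-^ (2 ^ (e ∸ r)) q) ⟩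
  ι ((2 ^ (e ∸ r)) ^ q)                            ≡⟨ cong ι (ℕₚ.^-*-assoc 2 (e ∸ r) q) ⟩
  ι (2 ^ ((e ∸ r) * q))                            ≡⟨ ι-2^ ((e ∸ r) * q) ⟩
  pow2ℕ ((e ∸ r) * q)                              ≡⟨ pow2ℕ-split ((e ∸ r) * q) (r * q) ⟩
  pow2ℕ ((e ∸ r) * q + r * q) ℚ.* halfPow (r * q)  ≡⟨ cong (λ x → pow2ℕ x ℚ.* halfPow (r * q)) exponent ⟩
  pow2ℕ (q * e) ℚ.* halfPow (r * q)                ∎
  where
  open ≡-Reasoning
  e r : ℕ
  e = k + m + 2
  r = rank (D m k t η)
  r≤e : r ≤ e
  r≤e = ℕₚ.≤-trans (rank≤width k (D m k t η) (D-width m k t η)) (ℕₚ.≤-trans (ℕₚ.m≤m+n k m) (ℕₚ.m≤m+n (k + m) 2))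
  exponent : (e ∸ r) * q + r * q ≡ q * e
  exponent = trans (sym (ℕₚ.*-distribʳ-+ q (e ∸ r) r)) (trans (cong (_* q) (ℕₚ.m∸n+n≡m r≤e)) (ℕₚ.*-comm e q))

∑-Γ : ∀ m k (h : ℕ → ℚ) → Σℚ.∑[ i ∈ upTo (suc (k ⊓ (2 + m))) ] (ι (Γ m k i) ℚ.* h i)
  ≡ Σℚ.∑[ a ∈ vecs (k + m) ] Σℚ.∑[ b ∈ vecs k ] h (rank (D m k (ext a) (ext b)))
∑-Γ m k h = begin
  Σℚ.∑[ i ∈ upTo M ] (ι (Γ m k i) ℚ.* h i)
    ≡⟨ Σℚ.∑-cong (upTo M) (λ i → cong (ℚ._* h i) (ι-sumℕ (λ a → count (λ b → R a b ≡ᵇ i) (vecs k)) (vecs (k + m)))) ⟩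
  Σℚ.∑[ i ∈ upTo M ] (Σℚ.∑[ a ∈ vecs (k + m) ] ι (count (λ b → R a b ≡ᵇ i) (vecs k)) ℚ.* h i)
    ≡⟨ Σℚ.∑-cong (upTo M) (λ i → sym (Σℚ.∑-⊗ʳ (h i) (λ a → ι (count (λ b → R a b ≡ᵇ i) (vecs k))) (vecs (k + m)))) ⟩
  Σℚ.∑[ i ∈ upTo M ] Σℚ.∑[ a ∈ vecs (k + m) ] (ι (count (λ b → R a b ≡ᵇ i) (vecs k)) ℚ.* h i)
    ≡⟨ Σℚ.∑-comm (λ i a → ι (count (λ b → R a b ≡ᵇ i) (vecs k)) ℚ.* h i) (upTo M) (vecs (k + m)) ⟩
  Σℚ.∑[ a ∈ vecs (k + m) ] Σℚ.∑[ i ∈ upTo M ] (ι (count (λ b → R a b ≡ᵇ i) (vecs k)) ℚ.* h i)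
    ≡⟨ Σℚ.∑-cong (vecs (k + m)) (λ a →
         ∑-fibres (R a) h M (vecs k) (All.universal (λ b → rank-D m k (ext a) (ext b)) (vecs k))) ⟩
  Σℚ.∑[ a ∈ vecs (k + m) ] Σℚ.∑[ b ∈ vecs k ] h (R a b) ∎
  where
  open ≡-Reasoning
  M : ℕ
  M = suc (k ⊓ (2 + m))
  R : List Bool → List Bool → ℕ
  R a b = rank (D m k (ext a) (ext b))

integrand-cylinder : ∀ m k q → Cylinder (k + m) k (λ t η → ℤ._^_ (f m k t η) q ℚ./ 1)
integrand-cylinder m k q {t} {t′} {η} {η′} t≈t′ η≈η′ = begin
  ℤ._^_ (f m k t η) q ℚ./ 1                              ≡⟨ integrand-value m k q t η ⟩
  P ℚ.* halfPow (rank (D m k t η) * q)                   ≡⟨ cong (λ M → P ℚ.* halfPow (rank M * q))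
                                                                 (D-cylinder m k t≈t′ η≈η′) ⟩
  P ℚ.* halfPow (rank (D m k t′ η′) * q)                 ≡⟨ sym (integrand-value m k q t′ η′) ⟩
  ℤ._^_ (f m k t′ η′) q ℚ./ 1                            ∎
  where
  open ≡-Reasoning
  P : ℚ
  P = pow2ℕ (q * (k + m + 2))

∑∑-integrand : ∀ m k q →
  Σℚ.∑[ a ∈ vecs (k + m) ] Σℚ.∑[ b ∈ vecs k ] (ℤ._^_ (f m k (ext a) (ext b)) q ℚ./ 1)
    ≡ pow2ℕ (q * (k + m + 2)) ℚ.* Σℚ.∑[ i ∈ upTo (suc (k ⊓ (2 + m))) ] (ι (Γ m k i) ℚ.* halfPow (i * q))
∑∑-integrand m k q = begin
  Σℚ.∑[ a ∈ vecs (k + m) ] Σℚ.∑[ b ∈ vecs k ] (ℤ._^_ (f m k (ext a) (ext b)) q ℚ./ 1)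
    ≡⟨ Σℚ.∑-cong (vecs (k + m)) (λ a → Σℚ.∑-cong (vecs k) (λ b → integrand-value m k q (ext a) (ext b))) ⟩
  Σℚ.∑[ a ∈ vecs (k + m) ] Σℚ.∑[ b ∈ vecs k ] (P ℚ.* h (R a b))
    ≡⟨ Σℚ.∑-cong (vecs (k + m)) (λ a → Σℚ.∑-⊗ˡ P (λ b → h (R a b)) (vecs k)) ⟩
  Σℚ.∑[ a ∈ vecs (k + m) ] (P ℚ.* Σℚ.∑[ b ∈ vecs k ] h (R a b))
    ≡⟨ Σℚ.∑-⊗ˡ P (λ a → Σℚ.∑[ b ∈ vecs k ] h (R a b)) (vecs (k + m)) ⟩
  P ℚ.* Σℚ.∑[ a ∈ vecs (k + m) ] Σℚ.∑[ b ∈ vecs k ] h (R a b)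
    ≡⟨ cong (P ℚ.*_) (sym (∑-Γ m k h)) ⟩
  P ℚ.* Σℚ.∑[ i ∈ upTo (suc (k ⊓ (2 + m))) ] (ι (Γ m k i) ℚ.* h i) ∎
  where
  open ≡-Reasoning
  P : ℚ
  P = pow2ℕ (q * (k + m + 2))
  h : ℕ → ℚ
  h i = halfPow (i * q)
  R : List Bool → List Bool → ℕ
  R a b = rank (D m k (ext a) (ext b))

integral-formula : ∀ k m q (N₁ N₂ : ℕ) → k + m ≤ N₁ → k ≤ N₂ →
  integralℙ² N₁ N₂ (λ t η → ℤ._^_ (f m k t η) q ℚ./ 1)
    ≡ pow2 ((+ (q * (k + m + 2))) ℤ.- (+ (2 * k + m)))
      ℚ.* sumℚ (map (λ i → ((+ (Γ m k i)) ℚ./ 1) ℚ.* pow2 (ℤ.- (+ (i * q)))) (upTo (suc (k ⊓ (2 + m)))))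
integral-formula k m q N₁ N₂ k+m≤N₁ k≤N₂ = begin
  integralℙ² N₁ N₂ F
    ≡⟨ cong₂ (λ N₁ N₂ → integralℙ² N₁ N₂ F) (sym (ℕₚ.m+[n∸m]≡n k+m≤N₁)) (sym (ℕₚ.m+[n∸m]≡n k≤N₂)) ⟩
  integralℙ² (k + m + (N₁ ∸ (k + m))) (k + (N₂ ∸ k)) F
    ≡⟨ integral-cylinder (k + m) k (N₁ ∸ (k + m)) (N₂ ∸ k) F (integrand-cylinder m k q) ⟩
  (Σℚ.∑[ a ∈ vecs (k + m) ] Σℚ.∑[ b ∈ vecs k ] F (ext a) (ext b)) ℚ.* halfPow (k + m + k)
    ≡⟨ cong₂ ℚ._*_ (∑∑-integrand m k q) (cong halfPow (shuffle k m)) ⟩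
  pow2ℕ (q * (k + m + 2)) ℚ.* S ℚ.* halfPow (2 * k + m)
    ≡⟨ swap (pow2ℕ (q * (k + m + 2))) S (halfPow (2 * k + m)) ⟩
  pow2ℕ (q * (k + m + 2)) ℚ.* halfPow (2 * k + m) ℚ.* S
    ≡⟨ cong₂ ℚ._*_ (sym (pow2-⊖ (q * (k + m + 2)) (2 * k + m)))
                   (Σℚ.∑-cong (upTo (suc (k ⊓ (2 + m)))) (λ i → cong (ι (Γ m k i) ℚ.*_) (sym (pow2-neg (i * q))))) ⟩
  pow2 ((+ (q * (k + m + 2))) ℤ.- (+ (2 * k + m)))
    ℚ.* sumℚ (map (λ i → ((+ (Γ m k i)) ℚ./ 1) ℚ.* pow2 (ℤ.- (+ (i * q)))) (upTo (suc (k ⊓ (2 + m))))) ∎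
  where
  open ≡-Reasoning
  F : ℙ → ℙ → ℚ
  F t η = ℤ._^_ (f m k t η) q ℚ./ 1
  S : ℚ
  S = Σℚ.∑[ i ∈ upTo (suc (k ⊓ (2 + m))) ] (ι (Γ m k i) ℚ.* halfPow (i * q))
  shuffle : ∀ k m → k + m + k ≡ 2 * k + m
  shuffle = ℕ-Solver.solve-∀
  swap : ∀ a b c → a ℚ.* b ℚ.* c ≡ a ℚ.* c ℚ.* b
  swap = solve-∀ ℚ-ring

theorem1p7 : (k m q : ℕ) → 1 ≤ k → 1 ≤ q →
    ((t η : ℙ) → f m k t η ≡ + (2 ^ (k + m + 2 ∸ rank (D m k t η))))
    × ((N₁ N₂ : ℕ) → k + m ≤ N₁ → k ≤ N₂ →
        integralℙ² N₁ N₂ (λ t η → ℤ._^_ (f m k t η) q ℚ./ 1)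
          ≡ pow2 ((+ (q * (k + m + 2))) ℤ.- (+ (2 * k + m)))
            ℚ.* sumℚ (map (λ i → ((+ (Γ m k i)) ℚ./ 1) ℚ.* pow2 (ℤ.- (+ (i * q))))
                          (upTo (suc (k ⊓ (2 + m))))))
theorem1p7 k m q _ _ = f≡2^ m k , integral-formula k m q
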